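{- Let $g_1, g_2, \ldots, g_m$ be positive integers, set $v = \sum_{i=1}^m g_i$, and let $n$ be the number of indices $i \in \{1,\ldots,m\}$ with $g_i$ odd. Then $\sum_{i=1}^m g_i(v-g_i) \equiv 0 \pmod{4}$ if and only if $n \equiv 0$ or $1 \pmod{4}$. -}

module Defs where

open import Data.Nat using (ℕ; zero; suc; _+_; _%_)
open import Data.Fin using (Fin; zero; suc)

∑ : (m : ℕ) → (Fin m → ℕ) → ℕ
∑ zero    f = 0
∑ (suc m) f = f zero + ∑ m (λ i → f (suc i))

oddInd : ℕ → ℕ
oddInd k = k % 2

numOdd : (m : ℕ) → (Fin m → ℕ) → ℕ
numOdd m g = ∑ m (λ i → oddInd (g i))

{-# OPTIONS --safe #-}
-- With V = Σ gᵢ and n the number of odd gᵢ, the sum is V² − Σ gᵢ². Since k² ≡ k mod 2 (mod 4),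
-- Σ gᵢ² ≡ n and V² ≡ V mod 2 = n mod 2 ≡ n² (mod 4), so the sum is ≡ n² − n = n(n − 1) (mod 4),
-- and n(n − 1) ≡ 0 (mod 4) exactly when n ≡ 0 or 1 (mod 4).
module Submission where

open import Defs
open import Data.Nat using (ℕ; zero; suc; _+_; _*_; _∸_; _%_; _<_; _≤_; NonZero)
open import Data.Nat.Properties using (+-*-semiring; m≤m+n; <-≤-trans; *-distribˡ-+; m∸n+n≡m; +-comm)
open import Data.Nat.DivMod using (%-distribˡ-+; m%n%n≡m%n; [m+kn]%n≡m%n; m<n⇒m%n≡m; m%n<n)
open import Data.Nat.Solver using (module +-*-Solver)
open import Data.Fin using (Fin; zero; suc)
open import Data.Sum using (_⊎_; inj₁; inj₂)
open import Function using (_∘_)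
open import Function.Bundles using (_⇔_; mk⇔; Equivalence)
open import Relation.Binary.PropositionalEquality
open import Algebra.Properties.Semiring.Sum +-*-semiring using (sum; sum-remove; sum-cong-≗; ∑-distrib-+; *-distribʳ-sum)

open +-*-Solver

∑≡sum : ∀ m (f : Fin m → ℕ) → ∑ m f ≡ sum f
∑≡sum zero    f = refl
∑≡sum (suc m) f = cong (f zero +_) (∑≡sum m (f ∘ suc))

≤-∑ : ∀ {m} (f : Fin m → ℕ) i → f i ≤ ∑ m f
≤-∑ {suc m} f i = subst (f i ≤_) (sym (trans (∑≡sum (suc m) f) (sum-remove f))) (m≤m+n _ _)

%-congʳ-+ : ∀ a b c d .{{_ : NonZero d}} → a % d ≡ b % d → (a + c) % d ≡ (b + c) % d
%-congʳ-+ a b c d a≡b = begin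
  (a + c) % d           ≡⟨ %-distribˡ-+ a c d ⟩
  (a % d + c % d) % d   ≡⟨ cong (λ r → (r + c % d) % d) a≡b ⟩
  (b % d + c % d) % d   ≡⟨ %-distribˡ-+ b c d ⟨
  (b + c) % d           ∎
  where open ≡-Reasoning

∑-cong-% : ∀ d .{{_ : NonZero d}} m (f h : Fin m → ℕ) →
  (∀ i → f i % d ≡ h i % d) → ∑ m f % d ≡ ∑ m h % d
∑-cong-% d zero    f h f≡h = refl
∑-cong-% d (suc m) f h f≡h = begin
  (f zero + ∑ m (f ∘ suc)) % d
    ≡⟨ %-distribˡ-+ (f zero) _ d ⟩
  (f zero % d + ∑ m (f ∘ suc) % d) % d
    ≡⟨ cong₂ (λ x y → (x + y) % d) (f≡h zero) (∑-cong-% d m _ _ (f≡h ∘ suc)) ⟩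
  (h zero % d + ∑ m (h ∘ suc) % d) % d
    ≡⟨ %-distribˡ-+ (h zero) _ d ⟨
  (h zero + ∑ m (h ∘ suc)) % d ∎
  where open ≡-Reasoning

∑-*-complement+∑-squares≡∑² : ∀ m (g : Fin m → ℕ) →
  ∑ m (λ i → g i * (∑ m g ∸ g i)) + ∑ m (λ i → g i * g i) ≡ ∑ m g * ∑ m g
∑-*-complement+∑-squares≡∑² m g = begin
  ∑ m (λ i → g i * (V ∸ g i)) + ∑ m (λ i → g i * g i)
    ≡⟨ cong₂ _+_ (∑≡sum m _) (∑≡sum m _) ⟩
  sum (λ i → g i * (V ∸ g i)) + sum (λ i → g i * g i)
    ≡⟨ ∑-distrib-+ (λ i → g i * (V ∸ g i)) (λ i → g i * g i) ⟨
  sum (λ i → g i * (V ∸ g i) + g i * g i)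
    ≡⟨ sum-cong-≗ term≡ ⟩
  sum (λ i → g i * V)
    ≡⟨ *-distribʳ-sum V g ⟨
  sum g * V
    ≡⟨ cong (_* V) (∑≡sum m g) ⟨
  V * V ∎
  where
  open ≡-Reasoning
  V = ∑ m g
  term≡ : ∀ i → g i * (V ∸ g i) + g i * g i ≡ g i * V
  term≡ i = trans (sym (*-distribˡ-+ (g i) (V ∸ g i) (g i))) (cong (g i *_) (m∸n+n≡m (≤-∑ g i)))

[n*n]%4≡n%2 : ∀ n → (n * n) % 4 ≡ n % 2
[n*n]%4≡n%2 zero          = refl
[n*n]%4≡n%2 (suc zero)    = refl
[n*n]%4≡n%2 (suc (suc n)) = begin
  (suc (suc n) * suc (suc n)) % 4  ≡⟨ cong (_% 4) (solve 1 (λ n → (con 2 :+ n) :* (con 2 :+ n) := n :* n :+ (n :+ con 1) :* con 4) refl n) ⟩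
  (n * n + (n + 1) * 4) % 4        ≡⟨ [m+kn]%n≡m%n (n * n) (n + 1) 4 ⟩
  (n * n) % 4                      ≡⟨ [n*n]%4≡n%2 n ⟩
  n % 2                            ≡⟨ [m+kn]%n≡m%n n 1 2 ⟨
  (n + 1 * 2) % 2                  ≡⟨ cong (_% 2) (+-comm n 2) ⟩
  suc (suc n) % 2                  ∎
  where open ≡-Reasoning

-- n * n + 3 * n stands for n(n − 1) modulo 4, avoiding truncated subtraction.
[n*n+3n]%4≡0⇔[n%4≡0⊎n%4≡1] : ∀ n → ((n * n + 3 * n) % 4 ≡ 0) ⇔ (n % 4 ≡ 0 ⊎ n % 4 ≡ 1)
[n*n+3n]%4≡0⇔[n%4≡0⊎n%4≡1] 0 = mk⇔ (λ _ → inj₁ refl) (λ _ → refl)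
[n*n+3n]%4≡0⇔[n%4≡0⊎n%4≡1] 1 = mk⇔ (λ _ → inj₂ refl) (λ _ → refl)
[n*n+3n]%4≡0⇔[n%4≡0⊎n%4≡1] 2 = mk⇔ (λ ()) (λ { (inj₁ ()) ; (inj₂ ()) })
[n*n+3n]%4≡0⇔[n%4≡0⊎n%4≡1] 3 = mk⇔ (λ ()) (λ { (inj₁ ()) ; (inj₂ ()) })
[n*n+3n]%4≡0⇔[n%4≡0⊎n%4≡1] (suc (suc (suc (suc n)))) =
  -- (4 + n) % 4 reduces to n % 4, so only the left side needs rewriting.
  subst (λ r → (r ≡ 0) ⇔ (n % 4 ≡ 0 ⊎ n % 4 ≡ 1)) (sym periodic) ([n*n+3n]%4≡0⇔[n%4≡0⊎n%4≡1] n)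
  where
  periodic : ((4 + n) * (4 + n) + 3 * (4 + n)) % 4 ≡ (n * n + 3 * n) % 4
  periodic = trans
    (cong (_% 4) (solve 1 (λ n → (con 4 :+ n) :* (con 4 :+ n) :+ con 3 :* (con 4 :+ n)
                             := (n :* n :+ con 3 :* n) :+ (con 2 :* n :+ con 7) :* con 4) refl n))
    ([m+kn]%n≡m%n (n * n + 3 * n) (2 * n + 7) 4)

[s+n]%4≡[n*n]%4⇒s%4≡[n*n+3n]%4 : ∀ s n → (s + n) % 4 ≡ (n * n) % 4 → s % 4 ≡ (n * n + 3 * n) % 4
[s+n]%4≡[n*n]%4⇒s%4≡[n*n+3n]%4 s n s+n≡n*n = begin
  s % 4                  ≡⟨ [m+kn]%n≡m%n s n 4 ⟨
  (s + n * 4) % 4        ≡⟨ cong (_% 4) (solve 2 (λ s n → s :+ n :* con 4 := (s :+ n) :+ con 3 :* n) refl s n) ⟩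
  ((s + n) + 3 * n) % 4  ≡⟨ %-congʳ-+ (s + n) (n * n) (3 * n) 4 s+n≡n*n ⟩
  (n * n + 3 * n) % 4    ∎
  where open ≡-Reasoning

∑-*-complement+numOdd≡numOdd² : ∀ m (g : Fin m → ℕ) →
  (∑ m (λ i → g i * (∑ m g ∸ g i)) + numOdd m g) % 4 ≡ (numOdd m g * numOdd m g) % 4
∑-*-complement+numOdd≡numOdd² m g = begin
  (S + n) % 4    ≡⟨ cong (_% 4) (+-comm S n) ⟩
  (n + S) % 4    ≡⟨ %-congʳ-+ Q n S 4 squares≡n ⟨
  (Q + S) % 4    ≡⟨ cong (_% 4) (trans (+-comm Q S) (∑-*-complement+∑-squares≡∑² m g)) ⟩
  (V * V) % 4    ≡⟨ [n*n]%4≡n%2 V ⟩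
  V % 2          ≡⟨ ∑-cong-% 2 m g (oddInd ∘ g) (λ i → sym (m%n%n≡m%n (g i) 2)) ⟩
  n % 2          ≡⟨ [n*n]%4≡n%2 n ⟨
  (n * n) % 4    ∎
  where
  open ≡-Reasoning
  V = ∑ m g
  S = ∑ m (λ i → g i * (V ∸ g i))
  Q = ∑ m (λ i → g i * g i)
  n = numOdd m g
  square≡oddInd : ∀ k → (k * k) % 4 ≡ oddInd k % 4
  square≡oddInd k = trans ([n*n]%4≡n%2 k) (sym (m<n⇒m%n≡m (<-≤-trans (m%n<n k 2) (m≤m+n 2 2))))
  squares≡n : Q % 4 ≡ n % 4
  squares≡n = ∑-cong-% 4 m _ _ (square≡oddInd ∘ g)

mainTheorem2 : (m : ℕ) (g : Fin m → ℕ) → (∀ i → 0 < g i) →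
    ((∑ m (λ i → g i * (∑ m g ∸ g i))) % 4 ≡ 0) ⇔ ((numOdd m g % 4 ≡ 0) ⊎ (numOdd m g % 4 ≡ 1))
mainTheorem2 m g _ = mk⇔ (to ∘ trans (sym residue)) (trans residue ∘ from)
  where
  n = numOdd m g
  open Equivalence ([n*n+3n]%4≡0⇔[n%4≡0⊎n%4≡1] n)
  residue : ∑ m (λ i → g i * (∑ m g ∸ g i)) % 4 ≡ (n * n + 3 * n) % 4
  residue = [s+n]%4≡[n*n]%4⇒s%4≡[n*n+3n]%4 (∑ m (λ i → g i * (∑ m g ∸ g i))) n (∑-*-complement+numOdd≡numOdd² m g)
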